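{- Let $n,m\ge1$ and let $(a_{i,j})_{(i,j)\in\mathbb{Z}^2}$ be an array such that $a_{i,j}a_{i+1,j+1}-a_{i,j+1}a_{i+1,j}=1$ for all $i,j$, $a_{i,j+n}=-a_{i,j}$ and $a_{i+m,j}=-a_{i,j}$ for all $i,j$, and $a_{i,j}$ is a positive integer for all $0\le i\le m-1$, $0\le j\le n-1$. Then the array is tame: every adjacent $3\times3$ minor vanishes, i.e. $\det\big(a_{i+k,j+l}\big)_{0\le k,l\le 2}=0$ for all $i,j\in\mathbb{Z}$. -}

module Defs where

open import Data.Nat using (ℕ)
open import Data.Integer using (ℤ; +_; _+_; _-_; _*_; -_; _<_)
open import Relation.Binary.PropositionalEquality using (_≡_)

Array : Set
Array = ℤ → ℤ → ℤ

Unimodular : Array → Set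
Unimodular a = ∀ i j → a i j * a (i + + 1) (j + + 1) - a i (j + + 1) * a (i + + 1) j ≡ + 1

AntiPeriodic : ℕ → ℕ → Array → Set
AntiPeriodic n m a = (∀ i j → a i (j + + n) ≡ - a i j) × (∀ i j → a (i + + m) j ≡ - a i j)
  where open import Data.Product using (_×_)

PositiveOnDomain : ℕ → ℕ → Array → Set
PositiveOnDomain n m a = ∀ (i j : ℕ) → i Data.Nat.< m → j Data.Nat.< n → + 0 < a (+ i) (+ j)
  where import Data.Nat

det3 : (ℕ → ℕ → ℤ) → ℤ
det3 M = M 0 0 * (M 1 1 * M 2 2 - M 1 2 * M 2 1)
       - M 0 1 * (M 1 0 * M 2 2 - M 1 2 * M 2 0)
       + M 0 2 * (M 1 0 * M 2 1 - M 1 1 * M 2 0)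

Tame : Array → Set
Tame a = ∀ i j → det3 (λ k l → a (i + + k) (j + + l)) ≡ + 0

module Submission where

-- Fix a 3×3 window M of the array.  The Desnanot–Jacobi
-- (Dodgson condensation) identity expresses det M times the centre entry
-- M₁₁ through the four adjacent 2×2 minors of M:
--     det M · M₁₁ = D₀₀ · D₁₁ − D₀₁ · D₁₀.
-- For a unimodular array all four minors are 1, so det M · M₁₁ = 0, and it
-- suffices to know that the array never vanishes.  That is where the
-- anti-periodicity enters: the absolute value of an anti-periodic function
-- is periodic, a periodic function on ℤ is determined by its values on the
-- residues modulo the period, and on the fundamental domain the entries are
-- positive.  Hence ∣a i j∣ equals the absolute value of a positive entry.

open import Defs
open import Data.Nat using (ℕ; _≥_; suc; NonZero)
import Data.Nat as ℕ
open import Data.Integer using (ℤ; +_; -[1+_]; _+_; _-_; _*_; -_; ∣_∣)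
open import Data.Integer.Properties using (∣-i∣≡∣i∣; ∣i∣≡0⇒i≡0; <⇒≢; i*j≡0⇒i≡0∨j≡0)
open import Data.Integer.DivMod using (_%ℕ_; _/ℕ_; a≡a%ℕn+[a/ℕn]*n; n%ℕd<d)
open import Data.Integer.Tactic.RingSolver using (solve-∀)
open import Data.Product using (_,_)
open import Data.Sum using (_⊎_; inj₁; inj₂)
open import Relation.Binary.PropositionalEquality
open import Relation.Nullary using (contradiction)

private
  zero-multiple : ∀ r p → r + + 0 * p ≡ r
  zero-multiple = solve-∀

  next-multiple : ∀ r k p → r + (+ 1 + k) * p ≡ (r + k * p) + p
  next-multiple = solve-∀

  cancel-multiple : ∀ r k p → (r + - (+ 1 + k) * p) + (+ 1 + k) * p ≡ r
  cancel-multiple = solve-∀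

module Periodic {A : Set} (p : ℕ) (g : ℤ → A) (period : ∀ x → g (x + + p) ≡ g x) where

  translate-ℕ : ∀ k r → g (r + + k * + p) ≡ g r
  translate-ℕ ℕ.zero  r = cong g (zero-multiple r (+ p))
  translate-ℕ (suc k) r = begin
    g (r + + suc k * + p)      ≡⟨ cong g (next-multiple r (+ k) (+ p)) ⟩
    g ((r + + k * + p) + + p)  ≡⟨ period (r + + k * + p) ⟩
    g (r + + k * + p)          ≡⟨ translate-ℕ k r ⟩
    g r                        ∎
    where open ≡-Reasoning

  -- Translating by any multiple of the period does not change g; a negative
  -- translate is undone by the corresponding non-negative one.
  translate : ∀ q r → g (r + q * + p) ≡ g r
  translate (+ k)    r = translate-ℕ k r
  translate -[1+ k ] r = begin
    g s                          ≡⟨ translate-ℕ (suc k) s ⟨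
    g (s + + suc k * + p)        ≡⟨ cong g (cancel-multiple r (+ k) (+ p)) ⟩
    g r                          ∎
    where
    open ≡-Reasoning
    s : ℤ
    s = r + -[1+ k ] * + p

  residue : .{{_ : NonZero p}} → ∀ x → g x ≡ g (+ (x %ℕ p))
  residue x = begin
    g x                                   ≡⟨ cong g (a≡a%ℕn+[a/ℕn]*n x p) ⟩
    g (+ (x %ℕ p) + (x /ℕ p) * + p)       ≡⟨ translate (x /ℕ p) (+ (x %ℕ p)) ⟩
    g (+ (x %ℕ p))                        ∎
    where open ≡-Reasoning

abs-periodic : ∀ (p : ℕ) (f : ℤ → ℤ) → (∀ x → f (x + + p) ≡ - f x) →
               ∀ x → ∣ f (x + + p) ∣ ≡ ∣ f x ∣
abs-periodic p f anti x = trans (cong ∣_∣ (anti x)) (∣-i∣≡∣i∣ (f x))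

-- Arrays that never vanish.  Anti-periodicity makes ∣a∣ doubly periodic, so
-- every ∣a i j∣ is the absolute value of an entry of the fundamental domain,
-- where the entries are positive.
nonvanishing : ∀ (n m : ℕ) .{{_ : NonZero n}} .{{_ : NonZero m}} (a : Array) →
               AntiPeriodic n m a → PositiveOnDomain n m a → ∀ i j → a i j ≢ + 0
nonvanishing n m a (anti-col , anti-row) positive i j a≡0 =
  <⇒≢ (positive i₀ j₀ (n%ℕd<d i m) (n%ℕd<d j n)) (sym (∣i∣≡0⇒i≡0 ∣a₀∣≡0))
  where
  i₀ j₀ : ℕ
  i₀ = i %ℕ m
  j₀ = j %ℕ n

  reduce : ∣ a i j ∣ ≡ ∣ a (+ i₀) (+ j₀) ∣
  reduce = trans
    (Periodic.residue m (λ x → ∣ a x j ∣) (abs-periodic m (λ x → a x j) (λ x → anti-row x j)) i)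
    (Periodic.residue n (λ y → ∣ a (+ i₀) y ∣) (abs-periodic n (a (+ i₀)) (anti-col (+ i₀))) j)

  ∣a₀∣≡0 : ∣ a (+ i₀) (+ j₀) ∣ ≡ 0
  ∣a₀∣≡0 = trans (sym reduce) (cong ∣_∣ a≡0)

minor2 : (ℕ → ℕ → ℤ) → ℕ → ℕ → ℤ
minor2 M k l = M k l * M (suc k) (suc l) - M k (suc l) * M (suc k) l

condensation : ∀ (M : ℕ → ℕ → ℤ) →
  det3 M * M 1 1 ≡ minor2 M 0 0 * minor2 M 1 1 - minor2 M 0 1 * minor2 M 1 0
condensation M = identity (M 0 0) (M 0 1) (M 0 2) (M 1 0) (M 1 1) (M 1 2) (M 2 0) (M 2 1) (M 2 2)
  where
  identity : ∀ x00 x01 x02 x10 x11 x12 x20 x21 x22 →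
    (x00 * (x11 * x22 - x12 * x21) - x01 * (x10 * x22 - x12 * x20) + x02 * (x10 * x21 - x11 * x20)) * x11
    ≡ (x00 * x11 - x01 * x10) * (x11 * x22 - x12 * x21) - (x01 * x12 - x02 * x11) * (x10 * x21 - x11 * x20)
  identity = solve-∀

unit-minors-singular : ∀ (M : ℕ → ℕ → ℤ) → (∀ k l → minor2 M k l ≡ + 1) →
                       M 1 1 ≢ + 0 → det3 M ≡ + 0
unit-minors-singular M unit centre≢0 = either (i*j≡0⇒i≡0∨j≡0 (det3 M) det·centre≡0)
  where
  det·centre≡0 : det3 M * M 1 1 ≡ + 0
  det·centre≡0 = begin
    det3 M * M 1 1                                              ≡⟨ condensation M ⟩
    minor2 M 0 0 * minor2 M 1 1 - minor2 M 0 1 * minor2 M 1 0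
      ≡⟨ cong₂ _-_ (cong₂ _*_ (unit 0 0) (unit 1 1)) (cong₂ _*_ (unit 0 1) (unit 1 0)) ⟩
    + 1 * + 1 - + 1 * + 1                                       ≡⟨⟩
    + 0                                                         ∎
    where open ≡-Reasoning

  either : det3 M ≡ + 0 ⊎ M 1 1 ≡ + 0 → det3 M ≡ + 0
  either (inj₁ det≡0)    = det≡0
  either (inj₂ centre≡0) = contradiction centre≡0 centre≢0

window : Array → ℤ → ℤ → ℕ → ℕ → ℤ
window a i j k l = a (i + + k) (j + + l)

unimodular-window : ∀ (a : Array) → Unimodular a → ∀ i j k l → minor2 (window a i j) k l ≡ + 1
unimodular-window a unimodular i j k l =
  subst₂ (λ i′ j′ → a (i + + k) (j + + l) * a i′ j′ - a (i + + k) j′ * a i′ (j + + l) ≡ + 1)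
         (successor i (+ k)) (successor j (+ l))
         (unimodular (i + + k) (j + + l))
  where
  successor : ∀ i x → (i + x) + + 1 ≡ i + (+ 1 + x)
  successor = solve-∀

proposition3p2 : (n m : ℕ) → n ≥ 1 → m ≥ 1 → (a : Array) →
    Unimodular a → AntiPeriodic n m a → PositiveOnDomain n m a → Tame a
proposition3p2 n m n≥1 m≥1 a unimodular anti positive i j =
  unit-minors-singular (window a i j) (unimodular-window a unimodular i j) centre≢0
  where
  instance
    _ : NonZero n
    _ = ℕ.>-nonZero n≥1
    _ : NonZero m
    _ = ℕ.>-nonZero m≥1

  centre≢0 : window a i j 1 1 ≢ + 0
  centre≢0 = nonvanishing n m a anti positive (i + + 1) (j + + 1)
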